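{- Let $H=\mathcal{H}(G)$ be the injective hull of a graph $G$. For any $M\subseteq V(G)$, every $x\in V(G)$ satisfies $e_G^M(x)\ge d_G(x,C_G^{\kappa(H)}(M))+rad_G(M)$.
   Context: All graphs are finite, simple, undirected, unweighted and connected. A graph is Helly if every family of pairwise intersecting disks $D(v,r)=\{u: d(u,v)\le r\}$ has a common vertex. The injective hull $\mathcal{H}(G)$ is the unique minimal Helly graph containing $G$ as an isometric subgraph; $V(G)$ is identified with its image. In a graph $X$, $I(x,y)=\{u: d(x,u)+d(u,y)=d(x,y)\}$ and $S_k(x,y)=\{u\in I(x,y): d(x,u)=k\}$; the interval thinness $\kappa(X)$ is the smallest $\kappa$ such that $d(u,v)\le\kappa$ for all $x,y$, all $0\le k\le d(x,y)$ and all $u,v\in S_k(x,y)$. $e_G^M(v)=\max_{u\in M}d_G(v,u)$, $rad_G(M)=\min_{v\in V(G)}e_G^M(v)$, $C_G^{\ell}(M)=\{v: e_G^M(v)\le rad_G(M)+\ell\}$, $d_G(x,S)=\min_{s\in S}d_G(x,s)$. -}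

module Defs where

open import Data.Nat using (ℕ; zero; suc; _+_; _≤_; _⊔_; _⊓_; _≤ᵇ_)
open import Data.Bool using (Bool; true; false; _∨_; _∧_; if_then_else_)
open import Data.Fin using (Fin; _≟_)
open import Data.Fin.Subset using (Subset)
open import Data.Fin.Subset.Properties using (_∈?_)
open import Data.List using (List; []; _∷_; foldr; map; allFin; filter; filterᵇ)
open import Data.Bool.ListAction using (any)
open import Data.List.Relation.Unary.All using (All)
open import Data.Product using (Σ; ∃; _×_; _,_)
open import Relation.Nullary.Decidable using (⌊_⌋)
open import Relation.Binary.PropositionalEquality using (_≡_)

reach : {n : ℕ} → (Fin n → Fin n → Bool) → ℕ → Fin n → Fin n → Bool
reach adj zero    u v = ⌊ u ≟ v ⌋
reach {n} adj (suc k) u v =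
  reach adj k u v ∨ any (λ w → reach adj k u w ∧ adj w v) (allFin n)

-- search for the least j (starting from k, with given fuel) with reach j u v;
-- returns k + fuel if none is found.
distSearch : {n : ℕ} → (Fin n → Fin n → Bool) → Fin n → Fin n → ℕ → ℕ → ℕ
distSearch adj u v zero       k = k
distSearch adj u v (suc fuel) k =
  if reach adj k u v then k else distSearch adj u v fuel (suc k)

-- shortest-path distance: least k such that v is reachable from u by a walk
-- of length ≤ k (for a connected graph on n vertices this is < n).
rawDist : {n : ℕ} → (Fin n → Fin n → Bool) → Fin n → Fin n → ℕ
rawDist {n} adj u v = distSearch adj u v n 0

record Graph : Set where
  field
    order     : ℕ
    adj       : Fin order → Fin order → Bool
    symmetric : ∀ u v → adj u v ≡ adj v u
    irrefl    : ∀ u → adj u u ≡ false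
    connected : ∀ u v → ∃ λ k → reach adj k u v ≡ true

open Graph public

V : Graph → Set
V G = Fin (order G)

dist : (G : Graph) → V G → V G → ℕ
dist G = rawDist (adj G)

-- Helly graphs: every (finite) family of pairwise intersecting disks
-- D(v,r) has a common vertex.  A family is a list of (center, radius).

InDisk : (G : Graph) → V G → V G × ℕ → Set
InDisk G u (c , r) = dist G c u ≤ r

PairwiseIntersecting : (G : Graph) → List (V G × ℕ) → Set
PairwiseIntersecting G F =
  All (λ D₁ → All (λ D₂ → ∃ λ u → InDisk G u D₁ × InDisk G u D₂) F) F

Helly : Graph → Set
Helly G = (F : List (V G × ℕ)) → PairwiseIntersecting G F →
          ∃ λ u → All (InDisk G u) F

IsometricEmbedding : (G H : Graph) → (V G → V H) → Set
IsometricEmbedding G H φ = ∀ u v → dist H (φ u) (φ v) ≡ dist G u v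

-- H is the injective hull of G (via the isometric embedding φ, identifying
-- V(G) with its image): H is Helly, φ is isometric, and H is minimal: any
-- Helly graph H' isometrically embedded in H (via ψ) whose image contains
-- the image of G is all of H (ψ surjective).
IsInjectiveHull : (G H : Graph) → (V G → V H) → Set
IsInjectiveHull G H φ =
  Helly H × IsometricEmbedding G H φ ×
  ((H' : Graph) (ψ : V H' → V H) → Helly H' → IsometricEmbedding H' H ψ →
     (∀ u → ∃ λ w → ψ w ≡ φ u) → ∀ h → ∃ λ w → ψ w ≡ h)

-- κ bounds the distance between any two vertices of the same slice S_k(x,y)
-- of the interval I(x,y).
ThinBy : (X : Graph) → ℕ → Set
ThinBy X κ = ∀ x y u v →
  dist X x u + dist X u y ≡ dist X x y →
  dist X x v + dist X v y ≡ dist X x y →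
  dist X x u ≡ dist X x v →
  dist X u v ≤ κ

IsIntervalThinness : (X : Graph) → ℕ → Set
IsIntervalThinness X κ = ThinBy X κ × (∀ κ' → ThinBy X κ' → κ ≤ κ')

maxList : List ℕ → ℕ
maxList = foldr _⊔_ 0

-- minimum of a list (0 on the empty list)
minList : List ℕ → ℕ
minList xs = foldr _⊓_ (maxList xs) xs

ecc : (G : Graph) → Subset (order G) → V G → ℕ
ecc G M v = maxList (map (dist G v) (filter (_∈? M) (allFin (order G))))

rad : (G : Graph) → Subset (order G) → ℕ
rad G M = minList (map (ecc G M) (allFin (order G)))

isCenter : (G : Graph) → Subset (order G) → ℕ → V G → Bool
isCenter G M ℓ v = ecc G M v ≤ᵇ (rad G M + ℓ)

setDist : (G : Graph) → V G → (V G → Bool) → ℕ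
setDist G x S = minList (map (dist G x) (filterᵇ S (allFin (order G))))

-- Put r = rad(M), a = e^M(x) − r and pick a vertex c₀ with
-- e^M(c₀) = r.  If d(x,c₀) < a then c₀ itself is a centre within a of x.
-- Otherwise the disks D(x,a), D(c₀, d(x,c₀) − a) and D(m,r) (m ∈ M) pairwise
-- meet, so by the Helly property of H they share a point h.  The radii force
-- h onto the slice S_a(x,c₀) of I(x,c₀); a vertex c of G on a shortest
-- x–c₀ path with d(x,c) = a lies on the same slice, so d(c,h) ≤ κ and hence
-- e^M(c) ≤ r + κ, i.e. c ∈ C^κ(M) and d(x,c) = a.

module Submission where

open import Defs
open import Data.Nat using (ℕ; zero; suc; _+_; _≤_; _<_; _∸_; _⊓_; z≤n; s≤s; s≤s⁻¹; _≤′_; ≤′-refl; ≤′-step)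
open import Data.Nat.Properties
open import Data.Bool using (Bool; true; false; T; T?)
open import Data.Bool.Properties using (T-≡; T-∨; T-∧)
open import Data.Fin using (Fin)
open import Data.Fin.Subset using (Subset; _⊂_; ∣_∣) renaming (_∈_ to _∈ₛ_)
open import Data.Fin.Subset.Properties using (_∈?_; ∣p∣≤n; p⊂q⇒∣p∣<∣q∣)
open import Data.Fin.Properties using (all?; ¬∀⟶∃¬)
open import Data.Vec using (tabulate)
open import Data.Vec.Properties using (lookup∘tabulate; []=⇒lookup; lookup⇒[]=)
open import Data.List using (List; []; _∷_; map; filter; allFin)
open import Data.List.Properties using (foldr-preservesᵇ; foldr-preservesᵒ)
open import Data.List.Membership.Propositional using (_∈_)
open import Data.List.Membership.Propositional.Properties using (∈-allFin; ∈-map⁺; ∈-map⁻; ∈-filter⁺)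
open import Data.List.Relation.Unary.Any using (here; there)
import Data.List.Relation.Unary.Any as Any
open import Data.List.Relation.Unary.Any.Properties using (any⁺; any⁻; tabulate⁺; tabulate⁻)
open import Data.List.Relation.Unary.All as All using (All)
import Data.List.Relation.Unary.All.Properties as All
open import Data.Product using (∃; _×_; _,_; proj₁; proj₂)
import Data.Product as Product
open import Data.Sum using (_⊎_; inj₁; inj₂; [_,_])
import Data.Sum as Sum
open import Data.Empty using (⊥-elim)
open import Function using (_∘_)
open import Function.Bundles using (Equivalence)
open import Relation.Nullary using (¬_; Dec; yes; no)
open import Relation.Nullary.Decidable using (toWitness; fromWitness; map′; _→-dec_)
open import Relation.Binary.PropositionalEquality using (_≡_; _≢_; refl; sym; trans; cong; cong₂; subst)

open Equivalence using (to; from)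

module _ {n : ℕ} (adj : Fin n → Fin n → Bool) where

  -- There is a walk of length at most k from u to v.  (A record rather than
  -- a bare T (reach …), so that k, u and v can be inferred.)
  record Reach (k : ℕ) (u v : Fin n) : Set where
    constructor reached
    field holds : T (reach adj k u v)

  open Reach

  reach-refl : ∀ u → Reach 0 u u
  reach-refl u = reached (fromWitness refl)

  reach-zero : ∀ {u v} → Reach 0 u v → u ≡ v
  reach-zero r = toWitness (holds r)

  reach-suc : ∀ {k u v} → Reach k u v → Reach (suc k) u v
  reach-suc r = reached (from T-∨ (inj₁ (holds r)))

  reach-step : ∀ {k u w v} → Reach k u w → T (adj w v) → Reach (suc k) u v
  reach-step {w = w} r a =
    reached (from T-∨ (inj₂ (any⁺ _ (tabulate⁺ w (from T-∧ (holds r , a))))))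

  reach-last : ∀ {k u v} → Reach (suc k) u v →
               Reach k u v ⊎ ∃ λ w → Reach k u w × T (adj w v)
  reach-last r = Sum.map reached (λ a → Product.map₂ (Product.map₁ reached ∘ to T-∧) (tabulate⁻ (any⁻ _ _ a)))
                         (to T-∨ (holds r))

  reach-mono : ∀ {i j u v} → i ≤′ j → Reach i u v → Reach j u v
  reach-mono ≤′-refl       r = r
  reach-mono (≤′-step i≤j) r = reach-suc (reach-mono i≤j r)

  reach-trans : ∀ {a} b {u w v} → Reach a u w → Reach b w v → Reach (a + b) u v
  reach-trans {a} zero r s rewrite reach-zero s | +-identityʳ a = r
  reach-trans {a} (suc b) r s rewrite +-suc a b with reach-last s
  ... | inj₁ s′           = reach-suc (reach-trans b r s′)
  ... | inj₂ (z , s′ , e) = reach-step (reach-trans b r s′) e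

  ball : ℕ → Fin n → Subset n
  ball k u = tabulate (reach adj k u)

  ∈-ball⁺ : ∀ {k u v} → Reach k u v → v ∈ₛ ball k u
  ∈-ball⁺ {k} {u} {v} r = lookup⇒[]= v _ (trans (lookup∘tabulate _ v) (to T-≡ (holds r)))

  ∈-ball⁻ : ∀ k u {v} → v ∈ₛ ball k u → Reach k u v
  ∈-ball⁻ k u {v} p = reached (from T-≡ (trans (sym (lookup∘tabulate _ v)) ([]=⇒lookup p)))

  Stable : Fin n → ℕ → Set
  Stable u k = ∀ v → Reach (suc k) u v → Reach k u v

  reach? : ∀ k u v → Dec (Reach k u v)
  reach? k u v = map′ reached holds (T? (reach adj k u v))

  stable-at? : ∀ u k v → Dec (Reach (suc k) u v → Reach k u v)
  stable-at? u k v = reach? (suc k) u v →-dec reach? k u v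

  stable-reach : ∀ {u k} → Stable u k → ∀ j {v} → Reach j u v → Reach k u v
  stable-reach st zero    r = reach-mono (≤⇒≤′ z≤n) r
  stable-reach st (suc j) r with reach-last r
  ... | inj₁ r′           = stable-reach st j r′
  ... | inj₂ (w , r′ , e) = st _ (reach-step (stable-reach st j r′) e)

  ball-grows : ∀ u k → ¬ Stable u k → ball k u ⊂ ball (suc k) u
  ball-grows u k ns =
    let v , ¬stable-at-v = ¬∀⟶∃¬ n _ (stable-at? u k) ns
        r , ¬r = counterexample (reach? (suc k) u v) ¬stable-at-v
    in (λ p → ∈-ball⁺ (reach-suc (∈-ball⁻ k u p))) , v , ∈-ball⁺ r , (λ p → ¬r (∈-ball⁻ k u p))
    where
    counterexample : ∀ {A B : Set} → Dec A → ¬ (A → B) → A × ¬ B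
    counterexample (yes a) ¬imp = a , λ b → ¬imp (λ _ → b)
    counterexample (no ¬a) ¬imp = ⊥-elim (¬imp (λ a → ⊥-elim (¬a a)))

  -- Pigeonhole: either some radius below K is stable, or the ball of
  -- radius K has at least K elements.
  stable-or-large : ∀ u K → (∃ λ j → j < K × Stable u j) ⊎ K ≤ ∣ ball K u ∣
  stable-or-large u zero = inj₂ z≤n
  stable-or-large u (suc K) with stable-or-large u K
  ... | inj₁ (j , j<K , st) = inj₁ (j , m≤n⇒m≤1+n j<K , st)
  ... | inj₂ large with all? (stable-at? u K)
  ...   | yes st = inj₁ (K , ≤-refl , st)
  ...   | no ns  = inj₂ (≤-trans (s≤s large) (p⊂q⇒∣p∣<∣q∣ (ball-grows u K ns)))

  reach-within-order : ∀ {u v} j → Reach j u v → ∃ λ k → k ≤ n × Reach k u v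
  reach-within-order {u} j r with stable-or-large u (suc n)
  ... | inj₁ (k , k<1+n , st) = k , s≤s⁻¹ k<1+n , stable-reach st j r
  ... | inj₂ large = ⊥-elim (<⇒≱ large (∣p∣≤n (ball (suc n) u)))

  search-below : ∀ {u v} fuel k {j} → k ≤ j → Reach j u v → distSearch adj u v fuel k ≤ j
  search-below zero k k≤j r = k≤j
  search-below {u} {v} (suc fuel) k {j} k≤j r with reach adj k u v in eq
  ... | true  = k≤j
  ... | false = search-below fuel (suc k) (≤∧≢⇒< k≤j k≢j) r
    where
    k≢j : k ≢ j
    k≢j refl = subst T eq (holds r)

  search-hits : ∀ {u v} fuel k {j} → k ≤ j → j ≤ k + fuel → Reach j u v →
                Reach (distSearch adj u v fuel k) u v
  search-hits zero k {j} k≤j j≤k r = reach-mono (≤⇒≤′ (≤-trans j≤k (≤-reflexive (+-identityʳ k)))) r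
  search-hits {u} {v} (suc fuel) k {j} k≤j j≤k+fuel r with reach adj k u v in eq
  ... | true  = reached (from T-≡ eq)
  ... | false = search-hits fuel (suc k) (≤∧≢⇒< k≤j k≢j) (≤-trans j≤k+fuel (≤-reflexive (+-suc k fuel))) r
    where
    k≢j : k ≢ j
    k≢j refl = subst T eq (holds r)

module _ (G : Graph) where

  private
    A : V G → V G → Bool
    A = adj G

  dist-reach : ∀ u v → Reach A (dist G u v) u v
  dist-reach u v =
    let j , r = connected G u v
        k , k≤n , r′ = reach-within-order A j (reached (from T-≡ r))
    in search-hits A (order G) 0 z≤n k≤n r′

  reach-dist : ∀ {j u v} → Reach A j u v → dist G u v ≤ j
  reach-dist r = search-below A (order G) 0 z≤n r

  dist-self : ∀ u → dist G u u ≡ 0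
  dist-self u = n≤0⇒n≡0 (reach-dist (reach-refl A u))

  dist-triangle : ∀ u w v → dist G u v ≤ dist G u w + dist G w v
  dist-triangle u w v = reach-dist (reach-trans A (dist G w v) (dist-reach u w) (dist-reach w v))

  reach-sym : ∀ k {u v} → Reach A k u v → Reach A k v u
  reach-sym zero r rewrite reach-zero A r = reach-refl A _
  reach-sym (suc k) r with reach-last A r
  ... | inj₁ r′           = reach-suc A (reach-sym k r′)
  ... | inj₂ (w , r′ , e) =
    reach-trans A k (reach-step A (reach-refl A _) (subst T (symmetric G _ _) e)) (reach-sym k r′)

  dist-sym : ∀ u v → dist G u v ≡ dist G v u
  dist-sym u v = ≤-antisym (reach-dist (reach-sym _ (dist-reach v u)))
                           (reach-dist (reach-sym _ (dist-reach u v)))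

  last-step : ∀ {u v m} → dist G u v ≡ suc m → ∃ λ z → dist G u z ≡ m × dist G z v ≤ 1
  last-step {u} {v} {m} e with reach-last A (subst (λ k → Reach A k u v) e (dist-reach u v))
  ... | inj₁ r = ⊥-elim (<⇒≱ (≤-reflexive (sym e)) (reach-dist r))
  ... | inj₂ (z , r , a) = z , ≤-antisym (reach-dist r) m≤duz , zv≤1
    where
    zv≤1 : dist G z v ≤ 1
    zv≤1 = reach-dist (reach-step A (reach-refl A z) a)
    m≤duz : m ≤ dist G u z
    m≤duz = s≤s⁻¹ (begin
      suc m                        ≡⟨ sym e ⟩
      dist G u v                   ≤⟨ dist-triangle u z v ⟩
      dist G u z + dist G z v      ≤⟨ +-monoʳ-≤ (dist G u z) zv≤1 ⟩
      dist G u z + 1               ≡⟨ +-comm (dist G u z) 1 ⟩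
      suc (dist G u z)             ∎)
      where open ≤-Reasoning

  geodesic-point : ∀ m {u v} → dist G u v ≡ m → ∀ k → k ≤ m →
                   ∃ λ w → dist G u w ≡ k × k + dist G w v ≡ m
  geodesic-point zero {u} e zero _ = u , dist-self u , e
  geodesic-point (suc m) {u} {v} e k k≤1+m with k ≟ suc m
  ... | yes refl = v , e , trans (cong (k +_) (dist-self v)) (+-identityʳ k)
  ... | no k≢1+m with last-step e
  ...   | z , uz , zv≤1 with geodesic-point m uz k (s≤s⁻¹ (≤∧≢⇒< k≤1+m k≢1+m))
  ...     | w , uw , kwz = w , uw , ≤-antisym upper lower
    where
    open ≤-Reasoning
    upper : k + dist G w v ≤ suc m
    upper = begin
      k + dist G w v                    ≤⟨ +-monoʳ-≤ k (dist-triangle w z v) ⟩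
      k + (dist G w z + dist G z v)     ≡⟨ sym (+-assoc k _ _) ⟩
      (k + dist G w z) + dist G z v     ≤⟨ +-mono-≤ (≤-reflexive kwz) zv≤1 ⟩
      m + 1                             ≡⟨ +-comm m 1 ⟩
      suc m                             ∎
    lower : suc m ≤ k + dist G w v
    lower = begin
      suc m                         ≡⟨ sym e ⟩
      dist G u v                    ≤⟨ dist-triangle u w v ⟩
      dist G u w + dist G w v       ≡⟨ cong (_+ dist G w v) uw ⟩
      k + dist G w v                ∎

  disks-meet : ∀ p q s t → dist G p q ≤ s + t → ∃ λ w → dist G p w ≤ s × dist G q w ≤ t
  disks-meet p q s t pq≤s+t with dist G p q ≤? s
  ... | yes pq≤s = q , pq≤s , ≤-trans (≤-reflexive (dist-self q)) z≤n
  ... | no pq≰s with geodesic-point _ refl s (<⇒≤ (≰⇒> pq≰s))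
  ...   | w , pw , swq = w , ≤-reflexive pw , qw≤t
    where
    qw≤t : dist G q w ≤ t
    qw≤t = +-cancelˡ-≤ s _ _ (begin
      s + dist G q w   ≡⟨ cong (s +_) (dist-sym q w) ⟩
      s + dist G w q   ≡⟨ swq ⟩
      dist G p q       ≤⟨ pq≤s+t ⟩
      s + t            ∎)
      where open ≤-Reasoning

maxList-upper : ∀ {y} xs → y ∈ xs → y ≤ maxList xs
maxList-upper {y} xs p =
  foldr-preservesᵒ {P = y ≤_} (λ a b → [ m≤n⇒m≤n⊔o b , m≤n⇒m≤o⊔n a ]) 0 xs
    (inj₂ (Any.map (λ { refl → ≤-refl }) p))

maxList-least : ∀ xs {B} → (∀ {y} → y ∈ xs → y ≤ B) → maxList xs ≤ B
maxList-least xs {B} bound = foldr-preservesᵇ {P = _≤ B} ⊔-lub z≤n (All.tabulate bound)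

minList-lower : ∀ {y} xs → y ∈ xs → minList xs ≤ y
minList-lower {y} xs p =
  foldr-preservesᵒ {P = _≤ y} (λ a b → [ m≤n⇒m⊓o≤n b , m≤n⇒o⊓m≤n a ]) (maxList xs) xs
    (inj₂ (Any.map (λ { refl → ≤-refl }) p))

minList-attained : ∀ {y} xs → y ∈ xs → ∃ λ z → z ∈ xs × z ≤ minList xs
minList-attained {y} xs p =
  foldr-preservesᵇ {P = λ m → ∃ λ z → z ∈ xs × z ≤ m} keep-smaller
    (y , p , maxList-upper xs p) (All.tabulate (λ q → _ , q , ≤-refl))
  where
  keep-smaller : ∀ {a b} → (∃ λ z → z ∈ xs × z ≤ a) → (∃ λ z → z ∈ xs × z ≤ b) →
                 ∃ λ z → z ∈ xs × z ≤ a ⊓ b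
  keep-smaller {a} {b} za zb with ⊓-sel a b
  ... | inj₁ eq = subst (λ m → ∃ λ z → z ∈ xs × z ≤ m) (sym eq) za
  ... | inj₂ eq = subst (λ m → ∃ λ z → z ∈ xs × z ≤ m) (sym eq) zb

module _ (G : Graph) (M : Subset (order G)) where

  members : List (V G)
  members = filter (_∈? M) (allFin (order G))

  ecc-upper : ∀ v {m} → m ∈ members → dist G v m ≤ ecc G M v
  ecc-upper v p = maxList-upper _ (∈-map⁺ (dist G v) p)

  ecc-least : ∀ v {B} → (∀ {m} → m ∈ members → dist G v m ≤ B) → ecc G M v ≤ B
  ecc-least v bound = maxList-least _ λ q →
    let m , p , eq = ∈-map⁻ (dist G v) q in subst (_≤ _) (sym eq) (bound p)

  rad-lower : ∀ v → rad G M ≤ ecc G M v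
  rad-lower v = minList-lower _ (∈-map⁺ (ecc G M) (∈-allFin v))

  -- The radius is realised by a vertex (the graph being non-empty).
  rad-attained : V G → ∃ λ c → ecc G M c ≤ rad G M
  rad-attained x =
    let e , q , e≤rad = minList-attained _ (∈-map⁺ (ecc G M) (∈-allFin x))
        c , _ , eq = ∈-map⁻ (ecc G M) q
    in c , subst (_≤ rad G M) eq e≤rad

  setDist-upper : ∀ ℓ x c → ecc G M c ≤ rad G M + ℓ → setDist G x (isCenter G M ℓ) ≤ dist G x c
  setDist-upper ℓ x c central = minList-lower _ (∈-map⁺ (dist G x)
    (∈-filter⁺ (λ v → T? (isCenter G M ℓ v)) (∈-allFin c) (≤⇒≤ᵇ central)))

helly-common-point : (G H : Graph) (φ : V G → V H) → Helly H → IsometricEmbedding G H φ →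
  (F : List (V G × ℕ)) →
  (∀ {D₁ D₂} → D₁ ∈ F → D₂ ∈ F → dist G (proj₁ D₁) (proj₁ D₂) ≤ proj₂ D₁ + proj₂ D₂) →
  ∃ λ h → All (λ D → dist H (φ (proj₁ D)) h ≤ proj₂ D) F
helly-common-point G H φ helly iso F close =
  let h , common = helly (map (Product.map₁ φ) F) pairwise in h , All.map⁻ common
  where
  pairwise : PairwiseIntersecting H (map (Product.map₁ φ) F)
  pairwise = All.map⁺ (All.tabulate λ p₁ → All.map⁺ (All.tabulate λ p₂ →
    disks-meet H _ _ _ _ (≤-trans (≤-reflexive (iso _ _)) (close p₁ p₂))))

hull-point : (G H : Graph) (φ : V G → V H) → Helly H → IsometricEmbedding G H φ →
  (M : Subset (order G)) (x c : V G) (a r : ℕ) → ecc G M x ≤ a + r → ecc G M c ≤ r →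
  ∃ λ h → dist H (φ x) h ≤ a × dist H (φ c) h ≤ dist G x c ∸ a ×
          (∀ {m} → m ∈ members G M → dist H (φ m) h ≤ r)
hull-point G H φ helly iso M x c a r ecc-x ecc-c =
  let h , common = helly-common-point G H φ helly iso F close
  in h , All.lookup common (here refl) , All.lookup common (there (here refl)) ,
     λ p → All.lookup common (there (there (∈-map⁺ (_, r) p)))
  where
  b : ℕ
  b = dist G x c ∸ a

  F : List (V G × ℕ)
  F = (x , a) ∷ (c , b) ∷ map (_, r) (members G M)

  x-M : ∀ {m} → m ∈ members G M → dist G x m ≤ a + r
  x-M p = ≤-trans (ecc-upper G M x p) ecc-x

  c-M : ∀ {m} → m ∈ members G M → dist G c m ≤ r
  c-M p = ≤-trans (ecc-upper G M c p) ecc-c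

  self : ∀ u {k} → dist G u u ≤ k
  self u = ≤-trans (≤-reflexive (dist-self G u)) z≤n

  swap : ∀ {u v k} → dist G u v ≤ k → dist G v u ≤ k
  swap {u} {v} le = ≤-trans (≤-reflexive (dist-sym G v u)) le

  Close : V G × ℕ → Set
  Close (p , s) = dist G p x ≤ s + a × dist G p c ≤ s + b ×
                  (∀ {m} → m ∈ members G M → dist G p m ≤ s + r)

  close-all : ∀ {D} → D ∈ F → Close D
  close-all (here refl) = self x , m≤n+m∸n (dist G x c) a , x-M
  close-all (there (here refl)) =
    swap (≤-trans (m≤n+m∸n (dist G x c) a) (≤-reflexive (+-comm a b))) , self c ,
    λ p → ≤-trans (c-M p) (m≤n+m r b)
  close-all (there (there q)) with ∈-map⁻ (_, r) q
  ... | m , p , refl =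
    swap (≤-trans (x-M p) (≤-reflexive (+-comm a r))) , swap (≤-trans (c-M p) (m≤m+n r b)) ,
    λ p′ → ≤-trans (dist-triangle G m c _) (+-mono-≤ (swap (c-M p)) (c-M p′))

  close : ∀ {D₁ D₂} → D₁ ∈ F → D₂ ∈ F → dist G (proj₁ D₁) (proj₁ D₂) ≤ proj₂ D₁ + proj₂ D₂
  close p₁ (here refl)         = proj₁ (close-all p₁)
  close p₁ (there (here refl)) = proj₁ (proj₂ (close-all p₁))
  close p₁ (there (there q)) with ∈-map⁻ (_, r) q
  ... | m , p , refl = proj₂ (proj₂ (close-all p₁)) p

-- If h is within a of x and within b of y where d(x,y) = a + b, then h lies
-- on the slice S_a(x,y); so does c, hence d(c,h) ≤ κ.
slice-close : (X : Graph) (κ : ℕ) → ThinBy X κ → ∀ {x y c h a b} →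
  dist X x y ≡ a + b → dist X x c ≡ a → dist X x c + dist X c y ≡ dist X x y →
  dist X x h ≤ a → dist X h y ≤ b → dist X c h ≤ κ
slice-close X κ thin {x} {y} {c} {h} {a} {b} xy xc c-on xh≤a hy≤b =
  thin x y c h c-on h-on (trans xc (sym xh≡a))
  where
  open ≤-Reasoning
  a+b≤ : a + b ≤ dist X x h + dist X h y
  a+b≤ = begin a + b ≡⟨ sym xy ⟩ dist X x y ≤⟨ dist-triangle X x h y ⟩ dist X x h + dist X h y ∎
  xh≡a : dist X x h ≡ a
  xh≡a = ≤-antisym xh≤a (+-cancelʳ-≤ b a _ (≤-trans a+b≤ (+-monoʳ-≤ _ hy≤b)))
  hy≡b : dist X h y ≡ b
  hy≡b = ≤-antisym hy≤b (+-cancelˡ-≤ a b _ (≤-trans a+b≤ (≤-reflexive (cong (_+ _) xh≡a))))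
  h-on : dist X x h + dist X h y ≡ dist X x y
  h-on = trans (cong₂ _+_ xh≡a hy≡b) (sym xy)

ecc-via-hull : (G H : Graph) (φ : V G → V H) → IsometricEmbedding G H φ →
  (M : Subset (order G)) (c : V G) (h : V H) (r κ : ℕ) → dist H (φ c) h ≤ κ →
  (∀ {m} → m ∈ members G M → dist H (φ m) h ≤ r) → ecc G M c ≤ r + κ
ecc-via-hull G H φ iso M c h r κ ch≤κ Mh = ecc-least G M c λ {m} p → begin
  dist G c m                       ≡⟨ sym (iso c m) ⟩
  dist H (φ c) (φ m)               ≤⟨ dist-triangle H (φ c) h (φ m) ⟩
  dist H (φ c) h + dist H h (φ m)  ≤⟨ +-mono-≤ ch≤κ (≤-trans (≤-reflexive (dist-sym H h (φ m))) (Mh p)) ⟩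
  κ + r                            ≡⟨ +-comm κ r ⟩
  r + κ                            ∎
  where open ≤-Reasoning

far-center : (G H : Graph) (φ : V G → V H) → Helly H → IsometricEmbedding G H φ →
  (κ : ℕ) → ThinBy H κ → (M : Subset (order G)) (x c₀ : V G) →
  ecc G M c₀ ≤ rad G M → ecc G M x ∸ rad G M ≤ dist G x c₀ →
  ∃ λ c → dist G x c ≡ ecc G M x ∸ rad G M × ecc G M c ≤ rad G M + κ
far-center G H φ helly iso κ thin M x c₀ ecc-c₀ a≤d =
  let h , xh , c₀h , Mh = hull-point G H φ helly iso M x c₀ a r ecc-x ecc-c₀
      c , xc , c-on = geodesic-point G _ refl a a≤d
  in c , xc , ecc-via-hull G H φ iso M c h r κ (on-slice xh c₀h xc c-on) Mh
  where
  r : ℕ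
  r = rad G M
  a : ℕ
  a = ecc G M x ∸ r
  ecc-x : ecc G M x ≤ a + r
  ecc-x = ≤-reflexive (sym (m∸n+n≡m (rad-lower G M x)))
  on-slice : ∀ {c h} → dist H (φ x) h ≤ a → dist H (φ c₀) h ≤ dist G x c₀ ∸ a →
             dist G x c ≡ a → a + dist G c c₀ ≡ dist G x c₀ → dist H (φ c) h ≤ κ
  on-slice {c} {h} xh c₀h xc c-on =
    slice-close H κ thin {φ x} {φ c₀} {φ c} {h} {a} {dist G x c₀ ∸ a}
      (trans (iso x c₀) (sym (m+[n∸m]≡n a≤d)))
      (trans (iso x c) xc)
      (trans (cong₂ _+_ (iso x c) (iso c c₀)) (trans (cong (_+ dist G c c₀) xc) (trans c-on (sym (iso x c₀)))))
      xh (≤-trans (≤-reflexive (dist-sym H h (φ c₀))) c₀h)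

close-center : (G H : Graph) (φ : V G → V H) → Helly H → IsometricEmbedding G H φ →
  (κ : ℕ) → ThinBy H κ → (M : Subset (order G)) (x : V G) →
  ∃ λ c → dist G x c ≤ ecc G M x ∸ rad G M × ecc G M c ≤ rad G M + κ
close-center G H φ helly iso κ thin M x with rad-attained G M x
... | c₀ , ecc-c₀ = by-distance (ecc G M x ∸ rad G M ≤? dist G x c₀)
  where
  by-distance : Dec (ecc G M x ∸ rad G M ≤ dist G x c₀) →
                ∃ λ c → dist G x c ≤ ecc G M x ∸ rad G M × ecc G M c ≤ rad G M + κ
  by-distance (no near) = c₀ , <⇒≤ (≰⇒> near) , ≤-trans ecc-c₀ (m≤m+n (rad G M) κ)
  by-distance (yes far) =
    let c , xc , central = far-center G H φ helly iso κ thin M x c₀ ecc-c₀ far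
    in c , ≤-reflexive xc , central

lemma14 : (G H : Graph) (φ : V G → V H) → IsInjectiveHull G H φ →
          (κ : ℕ) → IsIntervalThinness H κ →
          (M : Subset (order G)) (x : V G) →
          setDist G x (isCenter G M κ) + rad G M ≤ ecc G M x
lemma14 G H φ (helly , iso , _) κ (thin , _) M x
  with close-center G H φ helly iso κ thin M x
... | c , xc , central = begin
  setDist G x (isCenter G M κ) + rad G M  ≤⟨ +-monoˡ-≤ (rad G M) (setDist-upper G M κ x c central) ⟩
  dist G x c + rad G M                     ≤⟨ +-monoˡ-≤ (rad G M) xc ⟩
  ecc G M x ∸ rad G M + rad G M            ≡⟨ m∸n+n≡m (rad-lower G M x) ⟩
  ecc G M x                                ∎
  where open ≤-Reasoning
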